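{- Let $d_{n,1}$ denote the number of derangements of $[n]$ having exactly one right-to-left minimum. Then, as formal power series in $t$, $$\sum_{n\ge 0}d_{n+2,1}t^n=\cfrac{1}{1-\gamma_0t-\cfrac{\beta_1t^2}{1-\gamma_1t-\cfrac{\beta_2t^2}{1-\gamma_2 t-\cdots}}}$$ with $\gamma_n=2n+1$ for $n\ge 0$ and $\beta_n=n(n+1)$ for $n\ge 1$; that is, $$\sum_{n\ge 0}d_{n+2,1}t^n=\cfrac{1}{1-t-\cfrac{2t^2}{1-3t-\cfrac{6t^2}{\cdots}}}.$$
   Context: A derangement of $[n]$ is a permutation $\sigma$ with no fixed points. A right-to-left minimum of $\sigma$ is a value $\sigma(i)$ such that $\sigma(i)<\sigma(k)$ for all $k>i$. -}

module Defs where

open import Data.Nat as ℕ using (ℕ; zero; suc; _∸_)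
open import Data.Integer as ℤ using (ℤ; +_; _+_; _*_)
open import Data.Fin using (Fin; toℕ; _<_)
open import Data.Fin.Properties using (all?; _≟_)
import Data.Fin.Properties as FinP
open import Data.Vec using (Vec; []; _∷_; lookup)
open import Data.List using (List; []; _∷_; [_]; map; concatMap; filter; length; allFin)
open import Data.Product using (_×_; ∃)
open import Relation.Nullary using (¬_; Dec)
open import Relation.Nullary.Decidable using (_×-dec_; ¬?; _→-dec_)
open import Relation.Binary.PropositionalEquality using (_≡_)

-- Permutations of [n] are represented by their one-line notation, a
-- vector σ : Vec (Fin n) n with pairwise distinct entries
-- (positions and values 0-based: Fin n stands for [n]).

IsPerm : ∀ {n} → Vec (Fin n) n → Set
IsPerm {n} σ = ∀ (i j : Fin n) → lookup σ i ≡ lookup σ j → i ≡ j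

IsDerangement : ∀ {n} → Vec (Fin n) n → Set
IsDerangement {n} σ = ∀ (i : Fin n) → ¬ (lookup σ i ≡ i)

IsRLMin : ∀ {n} → Vec (Fin n) n → Fin n → Set
IsRLMin {n} σ i = ∀ (k : Fin n) → i < k → lookup σ i < lookup σ k

isPerm? : ∀ {n} (σ : Vec (Fin n) n) → Dec (IsPerm σ)
isPerm? σ = all? λ i → all? λ j → (lookup σ i ≟ lookup σ j) →-dec (i ≟ j)

isDerangement? : ∀ {n} (σ : Vec (Fin n) n) → Dec (IsDerangement σ)
isDerangement? σ = all? λ i → ¬? (lookup σ i ≟ i)

isRLMin? : ∀ {n} (σ : Vec (Fin n) n) (i : Fin n) → Dec (IsRLMin σ i)
isRLMin? σ i = all? λ k → (i FinP.<? k) →-dec (lookup σ i FinP.<? lookup σ k)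

numRLMin : ∀ {n} → Vec (Fin n) n → ℕ
numRLMin {n} σ = length (filter (isRLMin? σ) (allFin n))

allVecs : ∀ m n → List (Vec (Fin m) n)
allVecs m zero = [ [] ]
allVecs m (suc n) = concatMap (λ i → map (i ∷_) (allVecs m n)) (allFin m)

d1 : ℕ → ℕ
d1 n = length (filter (λ σ → isPerm? σ ×-dec (isDerangement? σ ×-dec (numRLMin σ ℕ.≟ 1))) (allVecs n n))

FPS : Set
FPS = ℕ → ℤ

sumTo : ℕ → (ℕ → ℤ) → ℤ
sumTo zero f = f 0
sumTo (suc n) f = sumTo n f + f (suc n)

one : FPS
one zero = + 1
one (suc _) = + 0

_⊕_ : FPS → FPS → FPS
(f ⊕ g) n = f n + g n

_•_ : ℤ → FPS → FPS
(c • f) n = c * f n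

_⊛_ : FPS → FPS → FPS
(f ⊛ g) n = sumTo n (λ k → f k * g (n ∸ k))

shift : FPS → FPS
shift f zero = + 0
shift f (suc n) = f n

pow : FPS → ℕ → FPS
pow f zero = one
pow f (suc j) = f ⊛ pow f j

-- 1/(1 - X) = Σ_j X^j, for a series X with zero constant term
-- (only terms j ≤ n contribute to the coefficient of t^n)
geom : FPS → FPS
geom X n = sumTo n (λ j → pow X j n)

-- Jacobi continued fraction
--   1/(1 - γ₀ t - β₁ t²/(1 - γ₁ t - β₂ t²/(1 - …)))
-- convergent k i = depth-k truncation starting at level i (tail replaced by 1):
--   convergent 0 i = 1
--   convergent (k+1) i = 1/(1 - γ_i t - β_{i+1} t² · convergent k (i+1))
-- The infinite J-fraction is the coefficientwise limit of convergent k 0.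

convergent : (γ β : ℕ → ℤ) → ℕ → ℕ → FPS
convergent γ β zero i = one
convergent γ β (suc k) i =
  geom (shift ((γ i • one) ⊕ (β (suc i) • shift (convergent γ β k (suc i)))))

JFractionEq : FPS → (γ β : ℕ → ℤ) → Set
JFractionEq S γ β = ∀ (n : ℕ) → ∃ λ K → ∀ k → K ℕ.≤ k → convergent γ β k 0 n ≡ S n

γc : ℕ → ℤ
γc n = + (2 ℕ.* n ℕ.+ 1)

βc : ℕ → ℤ
βc n = + (n ℕ.* (n ℕ.+ 1))

-- A J-fraction is the generating function of weighted Motzkin paths: cutting a
-- path at its last visit to height 0 gives the recursion satisfied by the
-- coefficients of 1/(1 - γ₀t - β₁t²·(next convergent)). For γ_h = 2h + 1 and
-- β_h = h(h + 1) the path weights T n h obey a recurrence in n alone, so that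
-- T (n + 2) 0 = (n + 2) T (n + 1) 0 + (n + 1) T n 0.
-- On the other side, a permutation has a single right-to-left minimum iff it
-- ends with its minimum, so d_{n+2,1} counts the bijections from positions
-- 0, …, n onto values 1, …, n + 1 avoiding the n cells (i, i): a rook number,
-- which expanding along a row shows to satisfy the same recurrence.

module Submission where

open import Defs
open import Data.Integer using (+_)
open import Data.Nat using (_+_)

open import Data.Nat as ℕ using (ℕ; zero; suc; _∸_; _≤_; _<_; z≤n; s≤s; _!)
import Data.Nat.Properties as ℕP
open import Data.Integer as ℤ using (ℤ)
  renaming (_+_ to _+ᶻ_; _*_ to _*ᶻ_; _-_ to _-ᶻ_)
import Data.Integer.Properties as ℤP
open import Data.Integer.Tactic.RingSolver using (solve-∀)
open import Data.Bool using (Bool; true; false; _∧_; _∨_; not; if_then_else_)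
open import Data.Bool.Properties
  using (not-injective; ∧-zeroʳ; ∧-identityʳ; ∧-conicalˡ; ∧-conicalʳ; ∧-idempotentCommutativeMonoid)
open import Algebra.Solver.IdempotentCommutativeMonoid ∧-idempotentCommutativeMonoid
  using (solve; _⊜_) renaming (_⊕_ to _∧′_)
open import Data.Fin as F using (Fin; zero; suc; toℕ; fromℕ; fromℕ<; punchOut)
open import Data.Fin.Properties
  using ( _≟_; any?; toℕ-injective; toℕ-fromℕ; toℕ-fromℕ<; toℕ≤pred[n]; suc-injective
        ; punchOut-injective; <⇒notInjective)
open import Data.Vec using (Vec; []; _∷_; lookup)
open import Data.List using (List; []; _∷_; _++_; map; concatMap; tabulate; allFin; filter; length)
open import Data.Product using (_×_; _,_; proj₁; proj₂; ∃)
open import Data.Empty using (⊥-elim)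
open import Relation.Binary.PropositionalEquality
open import Function.Bundles using (mk⇔)
open import Function.Definitions using (Injective)
open import Relation.Nullary using (Dec; yes; no; does; ¬_)
open import Relation.Nullary.Decidable using (_×-dec_; ¬?; dec-true; dec-false; does-⇔; decidable-stable)

-- Finite sums and geometric series

sumTo-cong : ∀ n {f g : ℕ → ℤ} → (∀ m → m ≤ n → f m ≡ g m) → sumTo n f ≡ sumTo n g
sumTo-cong zero f≡g = f≡g 0 z≤n
sumTo-cong (suc n) f≡g =
  cong₂ _+ᶻ_ (sumTo-cong n (λ m m≤n → f≡g m (ℕP.m≤n⇒m≤1+n m≤n))) (f≡g (suc n) ℕP.≤-refl)

sumTo-zero : ∀ n {f : ℕ → ℤ} → (∀ m → m ≤ n → f m ≡ + 0) → sumTo n f ≡ + 0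
sumTo-zero zero f≡0 = f≡0 0 z≤n
sumTo-zero (suc n) f≡0 =
  cong₂ _+ᶻ_ (sumTo-zero n (λ m m≤n → f≡0 m (ℕP.m≤n⇒m≤1+n m≤n))) (f≡0 (suc n) ℕP.≤-refl)

sumTo-+ : ∀ n (f g : ℕ → ℤ) → sumTo n (λ m → f m +ᶻ g m) ≡ sumTo n f +ᶻ sumTo n g
sumTo-+ zero f g = refl
sumTo-+ (suc n) f g =
  trans (cong (_+ᶻ (f (suc n) +ᶻ g (suc n))) (sumTo-+ n f g))
        (interchange (sumTo n f) (sumTo n g) (f (suc n)) (g (suc n)))
  where
  interchange : ∀ a b c d → (a +ᶻ b) +ᶻ (c +ᶻ d) ≡ (a +ᶻ c) +ᶻ (b +ᶻ d)
  interchange = solve-∀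

sumTo-* : ∀ n c (f : ℕ → ℤ) → sumTo n (λ m → c *ᶻ f m) ≡ c *ᶻ sumTo n f
sumTo-* zero c f = refl
sumTo-* (suc n) c f =
  trans (cong (_+ᶻ (c *ᶻ f (suc n))) (sumTo-* n c f))
        (sym (ℤP.*-distribˡ-+ c (sumTo n f) (f (suc n))))

sumTo-suc : ∀ n (f : ℕ → ℤ) → sumTo (suc n) f ≡ f 0 +ᶻ sumTo n (λ m → f (suc m))
sumTo-suc zero f = refl
sumTo-suc (suc n) f =
  trans (cong (_+ᶻ f (suc (suc n))) (sumTo-suc n f)) (ℤP.+-assoc (f 0) _ _)

sumTo-reverse : ∀ n (f : ℕ → ℤ) → sumTo n (λ m → f (n ∸ m)) ≡ sumTo n f
sumTo-reverse zero f = refl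
sumTo-reverse (suc n) f = begin
    sumTo (suc n) (λ m → f (suc n ∸ m))
  ≡⟨ sumTo-suc n _ ⟩
    f (suc n) +ᶻ sumTo n (λ m → f (n ∸ m))
  ≡⟨ cong (f (suc n) +ᶻ_) (sumTo-reverse n f) ⟩
    f (suc n) +ᶻ sumTo n f
  ≡⟨ ℤP.+-comm (f (suc n)) _ ⟩
    sumTo (suc n) f ∎
  where open ≡-Reasoning

sumTo-swap : ∀ a b (F : ℕ → ℕ → ℤ) →
  sumTo a (λ j → sumTo b (F j)) ≡ sumTo b (λ k → sumTo a (λ j → F j k))
sumTo-swap zero b F = refl
sumTo-swap (suc a) b F =
  trans (cong (_+ᶻ sumTo b (F (suc a))) (sumTo-swap a b F))
        (sym (sumTo-+ b (λ k → sumTo a (λ j → F j k)) (F (suc a))))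

sumTo-pad : ∀ m d {f : ℕ → ℤ} → (∀ j → m < j → j ≤ m + d → f j ≡ + 0) →
  sumTo (m + d) f ≡ sumTo m f
sumTo-pad m zero f≡0 rewrite ℕP.+-identityʳ m = refl
sumTo-pad m (suc d) {f} f≡0 rewrite ℕP.+-suc m d =
  trans (cong₂ _+ᶻ_ (sumTo-pad m d (λ j m<j j≤ → f≡0 j m<j (ℕP.m≤n⇒m≤1+n j≤)))
                   (f≡0 (suc (m + d)) (s≤s (ℕP.m≤m+n m d)) ℕP.≤-refl))
        (ℤP.+-identityʳ (sumTo m f))

pow-vanishes-below : ∀ (X : FPS) → X 0 ≡ + 0 → ∀ j m → m < j → pow X j m ≡ + 0
pow-vanishes-below X X₀≡0 (suc j) m m<j = sumTo-zero m term≡0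
  where
  term≡0 : ∀ k → k ≤ m → X k *ᶻ pow X j (m ∸ k) ≡ + 0
  term≡0 zero _ = cong (_*ᶻ pow X j m) X₀≡0
  term≡0 (suc k) k<m =
    trans (cong (X (suc k) *ᶻ_) (pow-vanishes-below X X₀≡0 j (m ∸ suc k) m∸k<j))
          (ℤP.*-zeroʳ (X (suc k)))
    where
    m∸k<j : m ∸ suc k < j
    m∸k<j = ℕP.<-≤-trans (ℕP.∸-monoʳ-< {o = 0} ℕP.0<1+n k<m) (ℕP.≤-pred m<j)

geom-suc : ∀ (X : FPS) → X 0 ≡ + 0 → ∀ n →
  geom X (suc n) ≡ sumTo n (λ k → X (suc k) *ᶻ geom X (n ∸ k))
geom-suc X X₀≡0 n = begin
    geom X (suc n)
  ≡⟨ sumTo-suc n (λ j → pow X j (suc n)) ⟩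
    + 0 +ᶻ sumTo n (λ j → pow X (suc j) (suc n))
  ≡⟨ ℤP.+-identityˡ _ ⟩
    sumTo n (λ j → pow X (suc j) (suc n))
  ≡⟨ sumTo-cong n (λ j _ → pow-suc j) ⟩
    sumTo n (λ j → sumTo n (λ k → X (suc k) *ᶻ pow X j (n ∸ k)))
  ≡⟨ sumTo-swap n n (λ j k → X (suc k) *ᶻ pow X j (n ∸ k)) ⟩
    sumTo n (λ k → sumTo n (λ j → X (suc k) *ᶻ pow X j (n ∸ k)))
  ≡⟨ sumTo-cong n (λ k k≤n → trans (sumTo-* n (X (suc k)) (λ j → pow X j (n ∸ k)))
                                    (cong (X (suc k) *ᶻ_) (truncate k k≤n))) ⟩
    sumTo n (λ k → X (suc k) *ᶻ geom X (n ∸ k)) ∎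
  where
  open ≡-Reasoning
  pow-suc : ∀ j → pow X (suc j) (suc n) ≡ sumTo n (λ k → X (suc k) *ᶻ pow X j (n ∸ k))
  pow-suc j =
    trans (sumTo-suc n (λ k → X k *ᶻ pow X j (suc n ∸ k)))
          (trans (cong (λ x → x *ᶻ pow X j (suc n) +ᶻ sumTo n (λ k → X (suc k) *ᶻ pow X j (n ∸ k))) X₀≡0)
                 (ℤP.+-identityˡ _))
  truncate : ∀ k → k ≤ n → sumTo n (λ j → pow X j (n ∸ k)) ≡ geom X (n ∸ k)
  truncate k k≤n =
    trans (cong (λ z → sumTo z (λ j → pow X j (n ∸ k))) (sym (ℕP.m∸n+n≡m k≤n)))
          (sumTo-pad (n ∸ k) k (λ j n∸k<j _ → pow-vanishes-below X X₀≡0 j (n ∸ k) n∸k<j))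

-- J-fractions and weighted Motzkin paths

module MotzkinPaths (γ β : ℕ → ℤ) where

  -- motzkin i n h: Motzkin paths of length n from height 0 to height h, where a
  -- level step at height j weighs γ (i + j) and a down step to j weighs β (i + j + 1).
  mutual
    motzkin : ℕ → ℕ → ℕ → ℤ
    motzkin i zero zero = + 1
    motzkin i zero (suc h) = + 0
    motzkin i (suc n) h =
      motzkin↓ i n h +ᶻ γ (i + h) *ᶻ motzkin i n h +ᶻ β (suc (i + h)) *ᶻ motzkin i n (suc h)

    motzkin↓ : ℕ → ℕ → ℕ → ℤ
    motzkin↓ i n zero = + 0
    motzkin↓ i n (suc h) = motzkin i n h

  -- cut at the last visit to height 0
  motzkin-lastVisit : ∀ i n h →
    motzkin i (suc n) (suc h) ≡ sumTo n (λ m → motzkin i m 0 *ᶻ motzkin (suc i) (n ∸ m) h)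
  motzkin-lastVisit i zero zero = base (γ (i + 1)) (β (suc (i + 1)))
    where base : ∀ g b → + 1 +ᶻ g *ᶻ + 0 +ᶻ b *ᶻ + 0 ≡ + 1 *ᶻ + 1
          base = solve-∀
  motzkin-lastVisit i zero (suc h) = base (γ (i + suc (suc h))) (β (suc (i + suc (suc h))))
    where base : ∀ g b → + 0 +ᶻ g *ᶻ + 0 +ᶻ b *ᶻ + 0 ≡ + 1 *ᶻ + 0
          base = solve-∀
  motzkin-lastVisit i (suc n) h = begin
      motzkin↓ i (suc n) (suc h) +ᶻ γ (i + suc h) *ᶻ motzkin i (suc n) (suc h)
        +ᶻ β (suc (i + suc h)) *ᶻ motzkin i (suc n) (suc (suc h))
    ≡⟨ cong₂ (λ x y → motzkin↓ i (suc n) (suc h) +ᶻ x +ᶻ y)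
         (cong₂ _*ᶻ_ (cong γ (ℕP.+-suc i h)) (motzkin-lastVisit i n h))
         (cong₂ _*ᶻ_ (cong (λ x → β (suc x)) (ℕP.+-suc i h)) (motzkin-lastVisit i n (suc h))) ⟩
      motzkin↓ i (suc n) (suc h) +ᶻ g *ᶻ S h +ᶻ b *ᶻ S (suc h)
    ≡⟨ split-last h ⟩
      S↓ +ᶻ g *ᶻ S h +ᶻ b *ᶻ S (suc h) +ᶻ A (suc n) *ᶻ motzkin (suc i) 0 h
    ≡⟨ cong (_+ᶻ A (suc n) *ᶻ motzkin (suc i) 0 h) (sym unfold-inner) ⟩
      sumTo n (λ m → A m *ᶻ motzkin (suc i) (suc n ∸ m) h) +ᶻ A (suc n) *ᶻ motzkin (suc i) 0 h
    ≡⟨ cong (λ z → sumTo n (λ m → A m *ᶻ motzkin (suc i) (suc n ∸ m) h) +ᶻ A (suc n) *ᶻ motzkin (suc i) z h)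
            (sym (ℕP.n∸n≡0 n)) ⟩
      sumTo (suc n) (λ m → A m *ᶻ motzkin (suc i) (suc n ∸ m) h) ∎
    where
    open ≡-Reasoning
    A : ℕ → ℤ
    A m = motzkin i m 0
    g b : ℤ
    g = γ (suc (i + h))
    b = β (suc (suc (i + h)))
    S : ℕ → ℤ
    S h′ = sumTo n (λ m → A m *ᶻ motzkin (suc i) (n ∸ m) h′)
    S↓ : ℤ
    S↓ = sumTo n (λ m → A m *ᶻ motzkin↓ (suc i) (n ∸ m) h)
    distribute : ∀ g b a d c c′ → a *ᶻ (d +ᶻ g *ᶻ c +ᶻ b *ᶻ c′) ≡ a *ᶻ d +ᶻ g *ᶻ (a *ᶻ c) +ᶻ b *ᶻ (a *ᶻ c′)
    distribute = solve-∀
    unfold-inner : sumTo n (λ m → A m *ᶻ motzkin (suc i) (suc n ∸ m) h) ≡ S↓ +ᶻ g *ᶻ S h +ᶻ b *ᶻ S (suc h)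
    unfold-inner = begin
        sumTo n (λ m → A m *ᶻ motzkin (suc i) (suc n ∸ m) h)
      ≡⟨ sumTo-cong n (λ m m≤n → trans (cong (λ z → A m *ᶻ motzkin (suc i) z h) (ℕP.+-∸-assoc 1 m≤n))
             (distribute g b (A m) _ _ _)) ⟩
        sumTo n (λ m → A m *ᶻ motzkin↓ (suc i) (n ∸ m) h +ᶻ g *ᶻ (A m *ᶻ motzkin (suc i) (n ∸ m) h)
                         +ᶻ b *ᶻ (A m *ᶻ motzkin (suc i) (n ∸ m) (suc h)))
      ≡⟨ sumTo-+ n _ _ ⟩
        sumTo n (λ m → A m *ᶻ motzkin↓ (suc i) (n ∸ m) h +ᶻ g *ᶻ (A m *ᶻ motzkin (suc i) (n ∸ m) h))
          +ᶻ sumTo n (λ m → b *ᶻ (A m *ᶻ motzkin (suc i) (n ∸ m) (suc h)))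
      ≡⟨ cong₂ _+ᶻ_ (trans (sumTo-+ n _ _) (cong (S↓ +ᶻ_) (sumTo-* n g _))) (sumTo-* n b _) ⟩
        S↓ +ᶻ g *ᶻ S h +ᶻ b *ᶻ S (suc h) ∎
    viaLevel viaDown : ℕ → ℤ
    viaLevel h′ = γ (suc (i + h′)) *ᶻ S h′
    viaDown h′ = β (suc (suc (i + h′))) *ᶻ S (suc h′)
    split-last : ∀ h′ →
      motzkin↓ i (suc n) (suc h′) +ᶻ viaLevel h′ +ᶻ viaDown h′
        ≡ sumTo n (λ m → A m *ᶻ motzkin↓ (suc i) (n ∸ m) h′) +ᶻ viaLevel h′ +ᶻ viaDown h′
            +ᶻ A (suc n) *ᶻ motzkin (suc i) 0 h′
    split-last zero =
      trans (ring (A (suc n)) (viaLevel 0) (viaDown 0))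
            (cong (λ s → s +ᶻ viaLevel 0 +ᶻ viaDown 0 +ᶻ A (suc n) *ᶻ + 1)
                  (sym (sumTo-zero n (λ m _ → ℤP.*-zeroʳ (A m)))))
      where ring : ∀ a x y → a +ᶻ x +ᶻ y ≡ + 0 +ᶻ x +ᶻ y +ᶻ a *ᶻ + 1
            ring = solve-∀
    split-last (suc h′) =
      trans (cong (λ d → d +ᶻ viaLevel (suc h′) +ᶻ viaDown (suc h′)) (motzkin-lastVisit i n h′))
            (ring (S h′) (viaLevel (suc h′)) (viaDown (suc h′)) (A (suc n)))
      where ring : ∀ d x y a → d +ᶻ x +ᶻ y ≡ d +ᶻ x +ᶻ y +ᶻ a *ᶻ + 0
            ring = solve-∀

  motzkin-return : ∀ i m → motzkin i (suc (suc m)) 0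
    ≡ γ i *ᶻ motzkin i (suc m) 0 +ᶻ β (suc i) *ᶻ sumTo m (λ j → motzkin (suc i) j 0 *ᶻ motzkin i (m ∸ j) 0)
  motzkin-return i m = begin
      + 0 +ᶻ γ (i + 0) *ᶻ motzkin i (suc m) 0 +ᶻ β (suc (i + 0)) *ᶻ motzkin i (suc m) 1
    ≡⟨ cong (λ z → + 0 +ᶻ γ z *ᶻ motzkin i (suc m) 0 +ᶻ β (suc z) *ᶻ motzkin i (suc m) 1) (ℕP.+-identityʳ i) ⟩
      + 0 +ᶻ γ i *ᶻ motzkin i (suc m) 0 +ᶻ β (suc i) *ᶻ motzkin i (suc m) 1
    ≡⟨ cong₂ (λ x y → x +ᶻ β (suc i) *ᶻ y) (ℤP.+-identityˡ (γ i *ᶻ motzkin i (suc m) 0))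
                                           (motzkin-lastVisit i m 0) ⟩
      γ i *ᶻ motzkin i (suc m) 0 +ᶻ β (suc i) *ᶻ sumTo m (λ j → motzkin i j 0 *ᶻ motzkin (suc i) (m ∸ j) 0)
    ≡⟨ cong (λ z → γ i *ᶻ motzkin i (suc m) 0 +ᶻ β (suc i) *ᶻ z) (sym reverse) ⟩
      γ i *ᶻ motzkin i (suc m) 0 +ᶻ β (suc i) *ᶻ sumTo m (λ j → motzkin (suc i) j 0 *ᶻ motzkin i (m ∸ j) 0) ∎
    where
    open ≡-Reasoning
    reverse : sumTo m (λ j → motzkin (suc i) j 0 *ᶻ motzkin i (m ∸ j) 0)
            ≡ sumTo m (λ j → motzkin i j 0 *ᶻ motzkin (suc i) (m ∸ j) 0)
    reverse = trans (sumTo-cong m (λ j j≤m →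
                      trans (ℤP.*-comm (motzkin (suc i) j 0) (motzkin i (m ∸ j) 0))
                            (cong (λ z → motzkin i (m ∸ j) 0 *ᶻ motzkin (suc i) z 0) (sym (ℕP.m∸[m∸n]≡n j≤m)))))
                    (sumTo-reverse m (λ j → motzkin i j 0 *ᶻ motzkin (suc i) (m ∸ j) 0))

  X : ℕ → ℕ → FPS
  X k i = shift ((γ i • one) ⊕ (β (suc i) • shift (convergent γ β k (suc i))))

  -- The coefficients of convergent (k + 1) i = 1/(1 - X k i) obey the
  -- recursion of motzkin-return as long as the inner convergent is exact.
  convergent≡motzkin : ∀ k i n → n < k → convergent γ β k i n ≡ motzkin i n 0
  convergent≡motzkin k i n = bounded n n ℕP.≤-refl k i
    where
    bounded : ∀ N n → n ≤ N → ∀ k i → n < k → convergent γ β k i n ≡ motzkin i n 0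
    bounded N zero _ (suc k) i _ = refl
    bounded (suc N) (suc zero) _ (suc k) i _ =
      trans (geom-suc (X k i) refl 0)
            (trans (ring (γ i) (β (suc i)))
                   (cong (λ z → + 0 +ᶻ γ z *ᶻ + 1 +ᶻ β (suc z) *ᶻ + 0) (sym (ℕP.+-identityʳ i))))
      where ring : ∀ g b → (g *ᶻ + 1 +ᶻ b *ᶻ + 0) *ᶻ + 1 ≡ + 0 +ᶻ g *ᶻ + 1 +ᶻ b *ᶻ + 0
            ring = solve-∀
    bounded (suc N) (suc (suc m)) (s≤s n≤N) (suc k) i (s≤s n<k) = begin
        geom Y (suc (suc m))
      ≡⟨ trans (geom-suc Y refl (suc m)) (sumTo-suc m (λ j → Y (suc j) *ᶻ geom Y (suc m ∸ j))) ⟩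
        Y 1 *ᶻ geom Y (suc m) +ᶻ sumTo m (λ j → Y (suc (suc j)) *ᶻ geom Y (m ∸ j))
      ≡⟨ cong₂ _+ᶻ_ (cong₂ _*ᶻ_ (level (γ i) (β (suc i))) (same-level (suc m) ℕP.≤-refl))
                   (sumTo-cong m (λ j j≤m → cong₂ _*ᶻ_
                     (trans (cong (λ z → γ i *ᶻ + 0 +ᶻ β (suc i) *ᶻ z) (next-level j j≤m))
                            (down (γ i) (β (suc i)) (motzkin (suc i) j 0)))
                     (same-level (m ∸ j) (ℕP.≤-trans (ℕP.m∸n≤m m j) (ℕP.n≤1+n m))))) ⟩
        γ i *ᶻ A (suc m) +ᶻ sumTo m (λ j → β (suc i) *ᶻ motzkin (suc i) j 0 *ᶻ A (m ∸ j))
      ≡⟨ cong (γ i *ᶻ A (suc m) +ᶻ_)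
              (trans (sumTo-cong m (λ j _ → ℤP.*-assoc (β (suc i)) (motzkin (suc i) j 0) (A (m ∸ j))))
                     (sumTo-* m (β (suc i)) (λ j → motzkin (suc i) j 0 *ᶻ A (m ∸ j)))) ⟩
        γ i *ᶻ A (suc m) +ᶻ β (suc i) *ᶻ sumTo m (λ j → motzkin (suc i) j 0 *ᶻ A (m ∸ j))
      ≡⟨ sym (motzkin-return i m) ⟩
        motzkin i (suc (suc m)) 0 ∎
      where
      open ≡-Reasoning
      Y : FPS
      Y = X k i
      A : ℕ → ℤ
      A j = motzkin i j 0
      same-level : ∀ j → j ≤ suc m → geom Y j ≡ A j
      same-level j j≤ = bounded N j (ℕP.≤-trans j≤ n≤N) (suc k) i (s≤s (ℕP.≤-trans j≤ (ℕP.<⇒≤ n<k)))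
      next-level : ∀ j → j ≤ m → convergent γ β k (suc i) j ≡ motzkin (suc i) j 0
      next-level j j≤m = bounded N j (ℕP.≤-trans j≤m (ℕP.≤-trans (ℕP.n≤1+n m) n≤N)) k (suc i)
                                 (ℕP.≤-<-trans j≤m (ℕP.<-trans (ℕP.n<1+n m) n<k))
      level : ∀ g b → g *ᶻ + 1 +ᶻ b *ᶻ + 0 ≡ g
      level = solve-∀
      down : ∀ g b t → g *ᶻ + 0 +ᶻ b *ᶻ t ≡ b *ᶻ t
      down = solve-∀

mutual
  T : ℕ → ℕ → ℤ
  T zero zero = + 1
  T zero (suc h) = + 0
  T (suc n) h = T↓ n h +ᶻ (+ n +ᶻ + h +ᶻ + 1) *ᶻ T n h +ᶻ + n *ᶻ T← n h

  T↓ : ℕ → ℕ → ℤ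
  T↓ n zero = + 0
  T↓ n (suc h) = T n h

  T← : ℕ → ℕ → ℤ
  T← zero h = + 0
  T← (suc n) h = T n h

T↓← : ℕ → ℕ → ℤ
T↓← n zero = + 0
T↓← n (suc h) = T← n h

T←← : ℕ → ℕ → ℤ
T←← zero h = + 0
T←← (suc n) h = T← n h

βpoly : ℤ → ℤ
βpoly h = (+ 1 +ᶻ h) *ᶻ (+ 2 +ᶻ h)

-- The identity that turns the defining recurrence of T, which never looks at
-- height h + 1, into the Motzkin recurrence for the weights γc and βc.
T-raise : ∀ n h → βpoly (+ h) *ᶻ T n (suc h) ≡ (+ n -ᶻ + h) *ᶻ T n h +ᶻ + n *ᶻ T← n h
T-raise zero zero = refl
T-raise zero (suc h) = ring (βpoly (+ suc h)) (+ 0 -ᶻ + suc h)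
  where ring : ∀ x y → x *ᶻ + 0 ≡ y *ᶻ + 0 +ᶻ + 0 *ᶻ + 0
        ring = solve-∀
T-raise (suc n) h = begin
    βpoly H *ᶻ (a +ᶻ (N +ᶻ (+ 1 +ᶻ H) +ᶻ + 1) *ᶻ b +ᶻ N *ᶻ c)
  ≡⟨ distribute (βpoly H) a (N +ᶻ (+ 1 +ᶻ H) +ᶻ + 1) b N c ⟩
    βpoly H *ᶻ a +ᶻ (N +ᶻ (+ 1 +ᶻ H) +ᶻ + 1) *ᶻ (βpoly H *ᶻ b) +ᶻ N *ᶻ (βpoly H *ᶻ c)
  ≡⟨ cong₂ (λ x y → βpoly H *ᶻ a +ᶻ (N +ᶻ (+ 1 +ᶻ H) +ᶻ + 1) *ᶻ x +ᶻ y) (T-raise n h) (raise-previous n) ⟩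
    βpoly H *ᶻ a +ᶻ (N +ᶻ (+ 1 +ᶻ H) +ᶻ + 1) *ᶻ ((N -ᶻ H) *ᶻ a +ᶻ N *ᶻ d)
      +ᶻ N *ᶻ ((N -ᶻ + 1 -ᶻ H) *ᶻ d +ᶻ (N -ᶻ + 1) *ᶻ e)
  ≡⟨ regroup N H a d e ⟩
    (H *ᶻ (H +ᶻ + 1) *ᶻ a -ᶻ N *ᶻ (a -ᶻ (N +ᶻ H) *ᶻ d -ᶻ (N -ᶻ + 1) *ᶻ e)) +ᶻ rest
  ≡⟨ cong (λ z → H *ᶻ (H +ᶻ + 1) *ᶻ a -ᶻ z +ᶻ rest) (sym (unfold n h)) ⟩
    (H *ᶻ (H +ᶻ + 1) *ᶻ a -ᶻ N *ᶻ T↓← n h) +ᶻ rest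
  ≡⟨ cong (_+ᶻ rest) (sym (raise-lower h)) ⟩
    (+ 1 +ᶻ N -ᶻ H) *ᶻ T↓ n h +ᶻ rest
  ≡⟨ factor N H a d (T↓ n h) ⟩
    (+ 1 +ᶻ N -ᶻ H) *ᶻ (T↓ n h +ᶻ (N +ᶻ H +ᶻ + 1) *ᶻ a +ᶻ N *ᶻ d) +ᶻ (+ 1 +ᶻ N) *ᶻ a ∎
  where
  open ≡-Reasoning
  N H a b c d e rest : ℤ
  N = + n
  H = + h
  a = T n h
  b = T n (suc h)
  c = T← n (suc h)
  d = T← n h
  e = T←← n h
  rest = (+ 1 +ᶻ N -ᶻ H) *ᶻ ((N +ᶻ H +ᶻ + 1) *ᶻ a +ᶻ N *ᶻ d) +ᶻ (+ 1 +ᶻ N) *ᶻ a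

  -- the next three facts are multiplied by n, which makes them hold also for n = 0
  raise-previous : ∀ n → + n *ᶻ (βpoly H *ᶻ T← n (suc h))
                         ≡ + n *ᶻ ((+ n -ᶻ + 1 -ᶻ H) *ᶻ T← n h +ᶻ (+ n -ᶻ + 1) *ᶻ T←← n h)
  raise-previous zero = trans (ℤP.*-zeroˡ (βpoly H *ᶻ T← 0 (suc h)))
                               (sym (ℤP.*-zeroˡ ((+ 0 -ᶻ + 1 -ᶻ H) *ᶻ T← 0 h +ᶻ (+ 0 -ᶻ + 1) *ᶻ T←← 0 h)))
  raise-previous (suc n′) = cong (+ suc n′ *ᶻ_) (trans (T-raise n′ h) (ring (+ n′) H (T n′ h) (T← n′ h)))
    where ring : ∀ N H d e → (N -ᶻ H) *ᶻ d +ᶻ N *ᶻ e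
                             ≡ (+ 1 +ᶻ N -ᶻ + 1 -ᶻ H) *ᶻ d +ᶻ (+ 1 +ᶻ N -ᶻ + 1) *ᶻ e
          ring = solve-∀
  unfold : ∀ n h → + n *ᶻ T↓← n h ≡ + n *ᶻ (T n h -ᶻ (+ n +ᶻ + h) *ᶻ T← n h -ᶻ (+ n -ᶻ + 1) *ᶻ T←← n h)
  unfold zero h = trans (ℤP.*-zeroˡ (T↓← 0 h))
                        (sym (ℤP.*-zeroˡ (T 0 h -ᶻ (+ 0 +ᶻ + h) *ᶻ T← 0 h -ᶻ (+ 0 -ᶻ + 1) *ᶻ T←← 0 h)))
  unfold (suc n′) zero = ring (+ n′) (T n′ 0) (T← n′ 0)
    where ring : ∀ N d e → (+ 1 +ᶻ N) *ᶻ + 0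
                   ≡ (+ 1 +ᶻ N) *ᶻ ((+ 0 +ᶻ (N +ᶻ + 0 +ᶻ + 1) *ᶻ d +ᶻ N *ᶻ e) -ᶻ ((+ 1 +ᶻ N) +ᶻ + 0) *ᶻ d
                                   -ᶻ ((+ 1 +ᶻ N) -ᶻ + 1) *ᶻ e)
          ring = solve-∀
  unfold (suc n′) (suc h′) = ring (+ n′) (+ 1 +ᶻ + h′) (T n′ h′) (T n′ (suc h′)) (T← n′ (suc h′))
    where ring : ∀ N h g d e → (+ 1 +ᶻ N) *ᶻ g
                   ≡ (+ 1 +ᶻ N) *ᶻ ((g +ᶻ (N +ᶻ h +ᶻ + 1) *ᶻ d +ᶻ N *ᶻ e) -ᶻ ((+ 1 +ᶻ N) +ᶻ h) *ᶻ d
                                   -ᶻ ((+ 1 +ᶻ N) -ᶻ + 1) *ᶻ e)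
          ring = solve-∀
  raise-lower : ∀ h → (+ 1 +ᶻ + n -ᶻ + h) *ᶻ T↓ n h ≡ + h *ᶻ (+ h +ᶻ + 1) *ᶻ T n h -ᶻ + n *ᶻ T↓← n h
  raise-lower zero = ring (+ n) (T n 0)
    where ring : ∀ N a → (+ 1 +ᶻ N -ᶻ + 0) *ᶻ + 0 ≡ + 0 *ᶻ (+ 0 +ᶻ + 1) *ᶻ a -ᶻ N *ᶻ + 0
          ring = solve-∀
  raise-lower (suc h′) =
    trans (shift-h (+ n) (+ h′) (T n h′) (+ n *ᶻ T← n h′))
          (trans (cong (_-ᶻ + n *ᶻ T← n h′) (sym (T-raise n h′))) (expand (+ h′) (T n (suc h′)) (+ n *ᶻ T← n h′)))
    where shift-h : ∀ N h l x → (+ 1 +ᶻ N -ᶻ (+ 1 +ᶻ h)) *ᶻ l ≡ ((N -ᶻ h) *ᶻ l +ᶻ x) -ᶻ x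
          shift-h = solve-∀
          expand : ∀ h a x → (+ 1 +ᶻ h) *ᶻ (+ 2 +ᶻ h) *ᶻ a -ᶻ x
                             ≡ (+ 1 +ᶻ h) *ᶻ ((+ 1 +ᶻ h) +ᶻ + 1) *ᶻ a -ᶻ x
          expand = solve-∀
  distribute : ∀ x a k b n c → x *ᶻ (a +ᶻ k *ᶻ b +ᶻ n *ᶻ c) ≡ x *ᶻ a +ᶻ k *ᶻ (x *ᶻ b) +ᶻ n *ᶻ (x *ᶻ c)
  distribute = solve-∀
  regroup : ∀ N h a d e →
    (+ 1 +ᶻ h) *ᶻ (+ 2 +ᶻ h) *ᶻ a +ᶻ (N +ᶻ (+ 1 +ᶻ h) +ᶻ + 1) *ᶻ ((N -ᶻ h) *ᶻ a +ᶻ N *ᶻ d)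
      +ᶻ N *ᶻ ((N -ᶻ + 1 -ᶻ h) *ᶻ d +ᶻ (N -ᶻ + 1) *ᶻ e)
    ≡ (h *ᶻ (h +ᶻ + 1) *ᶻ a -ᶻ N *ᶻ (a -ᶻ (N +ᶻ h) *ᶻ d -ᶻ (N -ᶻ + 1) *ᶻ e))
      +ᶻ ((+ 1 +ᶻ N -ᶻ h) *ᶻ ((N +ᶻ h +ᶻ + 1) *ᶻ a +ᶻ N *ᶻ d) +ᶻ (+ 1 +ᶻ N) *ᶻ a)
  regroup = solve-∀
  factor : ∀ N h a d l →
    (+ 1 +ᶻ N -ᶻ h) *ᶻ l +ᶻ ((+ 1 +ᶻ N -ᶻ h) *ᶻ ((N +ᶻ h +ᶻ + 1) *ᶻ a +ᶻ N *ᶻ d) +ᶻ (+ 1 +ᶻ N) *ᶻ a)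
      ≡ (+ 1 +ᶻ N -ᶻ h) *ᶻ (l +ᶻ (N +ᶻ h +ᶻ + 1) *ᶻ a +ᶻ N *ᶻ d) +ᶻ (+ 1 +ᶻ N) *ᶻ a
  factor = solve-∀

T-motzkin : ∀ n h → T (suc n) h ≡ T↓ n h +ᶻ γc h *ᶻ T n h +ᶻ βc (suc h) *ᶻ T n (suc h)
T-motzkin n h = sym (begin
    T↓ n h +ᶻ γc h *ᶻ T n h +ᶻ βc (suc h) *ᶻ T n (suc h)
  ≡⟨ cong₂ (λ x y → T↓ n h +ᶻ x *ᶻ T n h +ᶻ y *ᶻ T n (suc h)) γc-poly βc-poly ⟩
    T↓ n h +ᶻ (+ 2 *ᶻ + h +ᶻ + 1) *ᶻ T n h +ᶻ βpoly (+ h) *ᶻ T n (suc h)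
  ≡⟨ cong (T↓ n h +ᶻ (+ 2 *ᶻ + h +ᶻ + 1) *ᶻ T n h +ᶻ_) (T-raise n h) ⟩
    T↓ n h +ᶻ (+ 2 *ᶻ + h +ᶻ + 1) *ᶻ T n h +ᶻ ((+ n -ᶻ + h) *ᶻ T n h +ᶻ + n *ᶻ T← n h)
  ≡⟨ ring (T↓ n h) (+ n) (+ h) (T n h) (T← n h) ⟩
    T (suc n) h ∎)
  where
  open ≡-Reasoning
  γc-poly : γc h ≡ + 2 *ᶻ + h +ᶻ + 1
  γc-poly = trans (ℤP.pos-+ (2 ℕ.* h) 1) (cong (_+ᶻ + 1) (ℤP.pos-* 2 h))
  βc-poly : βc (suc h) ≡ βpoly (+ h)
  βc-poly = trans (ℤP.pos-* (suc h) (suc h + 1)) (cong (λ z → + suc h *ᶻ + z) (ℕP.+-comm (suc h) 1))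
  ring : ∀ l N h a d → l +ᶻ (+ 2 *ᶻ h +ᶻ + 1) *ᶻ a +ᶻ ((N -ᶻ h) *ᶻ a +ᶻ N *ᶻ d)
                       ≡ l +ᶻ (N +ᶻ h +ᶻ + 1) *ᶻ a +ᶻ N *ᶻ d
  ring = solve-∀

open MotzkinPaths γc βc using (motzkin; motzkin↓; convergent≡motzkin)

motzkin≡T : ∀ n h → motzkin 0 n h ≡ T n h
motzkin≡T zero zero = refl
motzkin≡T zero (suc h) = refl
motzkin≡T (suc n) h =
  trans (cong₂ (λ x y → x +ᶻ y +ᶻ βc (suc h) *ᶻ motzkin 0 n (suc h))
               (down h) (cong (γc h *ᶻ_) (motzkin≡T n h)))
        (trans (cong (λ z → T↓ n h +ᶻ γc h *ᶻ T n h +ᶻ βc (suc h) *ᶻ z) (motzkin≡T n (suc h)))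
               (sym (T-motzkin n h)))
  where
  down : ∀ h → motzkin↓ 0 n h ≡ T↓ n h
  down zero = refl
  down (suc h) = motzkin≡T n h

convergent≡T : ∀ k n → n < k → convergent γc βc k 0 n ≡ T n 0
convergent≡T k n n<k = trans (convergent≡motzkin k 0 n n<k) (motzkin≡T n 0)

-- Rook numbers

-- rook a r is the number of permutations of a letters avoiding r prescribed
-- cells of the a × a board, no two in a line; the recurrence drops one cell.
rook : ℕ → ℕ → ℤ
rook a zero = + (a !)
rook zero (suc r) = + 0
rook (suc a) (suc r) = rook (suc a) r -ᶻ rook a r

rook-drop : ∀ a r → rook (suc a) r ≡ rook (suc a) (suc r) +ᶻ rook a r
rook-drop a r = sym (ring (rook (suc a) r) (rook a r))
  where ring : ∀ x y → x -ᶻ y +ᶻ y ≡ x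
        ring = solve-∀

-- Expansion along a row without (resp. with) a prescribed cell: the letter of
-- that row either lies in one of the other r columns carrying a prescribed
-- cell, which leaves r - 1 of them, or in one of the remaining columns.
rook-expand : ∀ r a → r ≤ a → rook (suc a) r ≡ + r *ᶻ rook a (r ∸ 1) +ᶻ (+ suc a -ᶻ + r) *ᶻ rook a r
rook-expand-suc : ∀ r a → r ≤ a → rook (suc a) (suc r) ≡ + r *ᶻ rook a (r ∸ 1) +ᶻ (+ a -ᶻ + r) *ᶻ rook a r

rook-expand zero a _ = trans (ℤP.pos-* (suc a) (a !)) (ring (+ suc a) (rook a 0))
  where ring : ∀ x y → x *ᶻ y ≡ + 0 *ᶻ + 0 +ᶻ (x -ᶻ + 0) *ᶻ y
        ring = solve-∀
rook-expand (suc r) (suc a′) (s≤s r≤a′) = begin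
    rook (suc a) (suc r)
  ≡⟨ rook-expand-suc r a (ℕP.m≤n⇒m≤1+n r≤a′) ⟩
    + r *ᶻ rook a (r ∸ 1) +ᶻ (+ a -ᶻ + r) *ᶻ rook a r
  ≡⟨ cong (_+ᶻ (+ a -ᶻ + r) *ᶻ rook a r) (drop-cell r) ⟩
    + r *ᶻ (rook a r +ᶻ rook a′ (r ∸ 1)) +ᶻ (+ a -ᶻ + r) *ᶻ rook a r
  ≡⟨ cong (λ z → + r *ᶻ (z +ᶻ rook a′ (r ∸ 1)) +ᶻ (+ a -ᶻ + r) *ᶻ z) (rook-expand r a′ r≤a′) ⟩
    + r *ᶻ (x +ᶻ rook a′ (r ∸ 1)) +ᶻ (+ a -ᶻ + r) *ᶻ x
  ≡⟨ ring (+ r) (+ a′) (rook a′ (r ∸ 1)) (rook a′ r) ⟩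
    + suc r *ᶻ x +ᶻ (+ suc a -ᶻ + suc r) *ᶻ (x -ᶻ rook a′ r)
  ≡⟨ cong (λ z → + suc r *ᶻ z +ᶻ (+ suc a -ᶻ + suc r) *ᶻ (z -ᶻ rook a′ r)) (sym (rook-expand r a′ r≤a′)) ⟩
    + suc r *ᶻ rook a r +ᶻ (+ suc a -ᶻ + suc r) *ᶻ (rook a r -ᶻ rook a′ r) ∎
  where
  open ≡-Reasoning
  a = suc a′
  x = + r *ᶻ rook a′ (r ∸ 1) +ᶻ (+ a -ᶻ + r) *ᶻ rook a′ r
  drop-cell : ∀ r → + r *ᶻ rook a (r ∸ 1) ≡ + r *ᶻ (rook a r +ᶻ rook a′ (r ∸ 1))
  drop-cell zero = trans (ℤP.*-zeroˡ (rook a 0)) (sym (ℤP.*-zeroˡ (rook a 0 +ᶻ rook a′ 0)))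
  drop-cell (suc r) = cong (+ suc r *ᶻ_) (rook-drop a′ r)
  ring : ∀ r a′ P Y →
    r *ᶻ ((r *ᶻ P +ᶻ ((+ 1 +ᶻ a′) -ᶻ r) *ᶻ Y) +ᶻ P)
      +ᶻ ((+ 1 +ᶻ a′) -ᶻ r) *ᶻ (r *ᶻ P +ᶻ ((+ 1 +ᶻ a′) -ᶻ r) *ᶻ Y)
      ≡ (+ 1 +ᶻ r) *ᶻ (r *ᶻ P +ᶻ ((+ 1 +ᶻ a′) -ᶻ r) *ᶻ Y)
        +ᶻ (+ 1 +ᶻ (+ 1 +ᶻ a′) -ᶻ (+ 1 +ᶻ r)) *ᶻ ((r *ᶻ P +ᶻ ((+ 1 +ᶻ a′) -ᶻ r) *ᶻ Y) -ᶻ Y)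
  ring = solve-∀

rook-expand-suc r a r≤a =
  trans (cong (_-ᶻ rook a r) (rook-expand r a r≤a)) (ring (+ r) (rook a (r ∸ 1)) (+ a) (rook a r))
  where ring : ∀ r P a X → r *ᶻ P +ᶻ ((+ 1 +ᶻ a) -ᶻ r) *ᶻ X -ᶻ X ≡ r *ᶻ P +ᶻ (a -ᶻ r) *ᶻ X
        ring = solve-∀

rook-diag : ∀ n → rook (suc n) n ≡ T n 0
rook-diag zero = refl
rook-diag (suc zero) = refl
rook-diag (suc (suc n)) = begin
    rook (3 + n) (2 + n)
  ≡⟨ rook-expand-suc (suc n) (2 + n) (ℕP.n≤1+n (suc n)) ⟩
    + suc n *ᶻ rook (2 + n) n +ᶻ (+ (2 + n) -ᶻ + suc n) *ᶻ rook (2 + n) (suc n)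
  ≡⟨ cong₂ (λ x y → + suc n *ᶻ x +ᶻ y *ᶻ rook (2 + n) (suc n)) (rook-drop (suc n) n) step-diff ⟩
    + suc n *ᶻ (rook (2 + n) (suc n) +ᶻ rook (suc n) n) +ᶻ + 1 *ᶻ rook (2 + n) (suc n)
  ≡⟨ cong (+ suc n *ᶻ (rook (2 + n) (suc n) +ᶻ rook (suc n) n) +ᶻ_) (ℤP.*-identityˡ _) ⟩
    + suc n *ᶻ (rook (2 + n) (suc n) +ᶻ rook (suc n) n) +ᶻ rook (2 + n) (suc n)
  ≡⟨ cong₂ (λ x y → + suc n *ᶻ (x +ᶻ y) +ᶻ x) (rook-diag (suc n)) (rook-diag n) ⟩
    + suc n *ᶻ (T (suc n) 0 +ᶻ T n 0) +ᶻ T (suc n) 0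
  ≡⟨ ring (+ n) (T (suc n) 0) (T n 0) ⟩
    T (suc (suc n)) 0 ∎
  where
  open ≡-Reasoning
  step-diff : + (2 + n) -ᶻ + suc n ≡ + 1
  step-diff = trans (cong (_-ᶻ + suc n) (ℤP.pos-+ 1 (suc n))) (cancel (+ suc n))
    where cancel : ∀ x → + 1 +ᶻ x -ᶻ x ≡ + 1
          cancel = solve-∀
  ring : ∀ n a b → (+ 1 +ᶻ n) *ᶻ (a +ᶻ b) +ᶻ a
                   ≡ + 0 +ᶻ ((+ 1 +ᶻ n) +ᶻ + 0 +ᶻ + 1) *ᶻ a +ᶻ (+ 1 +ᶻ n) *ᶻ b
  ring = solve-∀

χ : Bool → ℕ
χ true = 1
χ false = 0

χᶻ : Bool → ℤ
χᶻ true = + 1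
χᶻ false = + 0

_==_ : ∀ {n} → Fin n → Fin n → Bool
i == j = does (i ≟ j)

count : (n : ℕ) → (Fin n → Bool) → ℕ
count zero P = 0
count (suc n) P = χ (P zero) + count n (λ i → P (suc i))

count-cong : ∀ n {P Q : Fin n → Bool} → (∀ i → P i ≡ Q i) → count n P ≡ count n Q
count-cong zero P≡Q = refl
count-cong (suc n) P≡Q = cong₂ (λ b c → χ b + c) (P≡Q zero) (count-cong n (λ i → P≡Q (suc i)))

count-const-false : ∀ n (P : Fin n → Bool) → (∀ i → P i ≡ false) → count n P ≡ 0
count-const-false zero P P≡false = refl
count-const-false (suc n) P P≡false rewrite P≡false zero = count-const-false n _ (λ i → P≡false (suc i))

count-const-true : ∀ n → count n (λ _ → true) ≡ n
count-const-true zero = refl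
count-const-true (suc n) = cong suc (count-const-true n)

count-split : ∀ n (P Q : Fin n → Bool) →
  count n P ≡ count n (λ i → P i ∧ Q i) + count n (λ i → P i ∧ not (Q i))
count-split zero P Q = refl
count-split (suc n) P Q with P zero | Q zero
... | false | _ = count-split n (λ i → P (suc i)) (λ i → Q (suc i))
... | true | true = cong suc (count-split n (λ i → P (suc i)) (λ i → Q (suc i)))
... | true | false = trans (cong suc (count-split n (λ i → P (suc i)) (λ i → Q (suc i)))) (sym (ℕP.+-suc _ _))

count-mono : ∀ n (P Q : Fin n → Bool) → (∀ i → P i ≡ true → Q i ≡ true) → count n P ≤ count n Q
count-mono zero P Q P⇒Q = z≤n
count-mono (suc n) P Q P⇒Q with P zero in P₀ | Q zero in Q₀
... | false | false = count-mono n _ _ (λ i → P⇒Q (suc i))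
... | false | true = ℕP.m≤n⇒m≤1+n (count-mono n _ _ (λ i → P⇒Q (suc i)))
... | true | true = s≤s (count-mono n _ _ (λ i → P⇒Q (suc i)))
... | true | false with () ← trans (sym Q₀) (P⇒Q zero P₀)

count-remove : ∀ n (P : Fin n → Bool) (j : Fin n) → count n (λ i → P i ∧ not (i == j)) + χ (P j) ≡ count n P
count-remove (suc n) P zero with P zero
... | false = trans (ℕP.+-identityʳ _) (count-cong n (λ i → ∧-identityʳ (P (suc i))))
... | true = trans (ℕP.+-comm _ 1) (cong suc (count-cong n (λ i → ∧-identityʳ (P (suc i)))))
count-remove (suc n) P (suc j) with P zero
... | false = count-remove n (λ i → P (suc i)) j
... | true = cong suc (count-remove n (λ i → P (suc i)) j)

count-single : ∀ n (j : Fin n) → count n (_== j) ≡ 1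
count-single (suc n) zero = cong suc (count-const-false n _ (λ i → refl))
count-single (suc n) (suc j) = count-single n j

count-≥1 : ∀ n (P : Fin n → Bool) i → P i ≡ true → 1 ≤ count n P
count-≥1 n P i Pi = subst (1 ≤_) (count-remove n P i)
  (subst (λ b → 1 ≤ count n (λ k → P k ∧ not (k == i)) + χ b) (sym Pi) (ℕP.m≤n+m 1 _))

count-≥2 : ∀ n (P : Fin n → Bool) i j → P i ≡ true → P j ≡ true → i ≢ j → 2 ≤ count n P
count-≥2 n P i j Pi Pj i≢j = subst (2 ≤_) (count-remove n P j)
  (ℕP.+-mono-≤ (count-≥1 n (λ k → P k ∧ not (k == j)) i (cong₂ _∧_ Pi (cong not (dec-false (i ≟ j) i≢j))))
               (ℕP.≤-reflexive (cong χ (sym Pj))))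

count-window : ∀ m p q → q ≤ m → count m (λ j → does (p ℕ.≤? toℕ j) ∧ does (toℕ j ℕ.<? q)) ≡ q ∸ p
count-window m p zero _ =
  trans (count-const-false m _ (λ j → ∧-zeroʳ (does (p ℕ.≤? toℕ j)))) (sym (ℕP.0∸n≡0 p))
count-window (suc m) zero (suc q) (s≤s q≤m) = cong suc (count-window m zero q q≤m)
count-window (suc m) (suc p) (suc q) (s≤s q≤m) =
  trans (count-cong m (λ j → cong (_∧ does (toℕ j ℕ.<? q))
                                  (does-⇔ (mk⇔ ℕP.≤-pred s≤s) (suc p ℕ.≤? suc (toℕ j)) (p ℕ.≤? toℕ j))))
        (count-window m p q q≤m)

sumFin : (n : ℕ) → (Fin n → ℤ) → ℤ
sumFin zero f = + 0
sumFin (suc n) f = f zero +ᶻ sumFin n (λ i → f (suc i))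

sumFin-cong : ∀ n {f g : Fin n → ℤ} → (∀ i → f i ≡ g i) → sumFin n f ≡ sumFin n g
sumFin-cong zero f≡g = refl
sumFin-cong (suc n) f≡g = cong₂ _+ᶻ_ (f≡g zero) (sumFin-cong n (λ i → f≡g (suc i)))

sumFin-zero : ∀ n → sumFin n (λ _ → + 0) ≡ + 0
sumFin-zero zero = refl
sumFin-zero (suc n) = trans (ℤP.+-identityˡ _) (sumFin-zero n)

sumFin-twoValued : ∀ n (A L : Fin n → Bool) (F : Fin n → ℤ) (V₁ V₂ : ℤ) →
  (∀ i → A i ≡ true → F i ≡ (if L i then V₁ else V₂)) →
  sumFin n (λ i → if A i then F i else + 0)
    ≡ + count n (λ i → A i ∧ L i) *ᶻ V₁ +ᶻ + count n (λ i → A i ∧ not (L i)) *ᶻ V₂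
sumFin-twoValued zero A L F V₁ V₂ F-values = ring V₁ V₂
  where ring : ∀ a b → + 0 ≡ + 0 *ᶻ a +ᶻ + 0 *ᶻ b
        ring = solve-∀
sumFin-twoValued (suc n) A L F V₁ V₂ F-values with A zero in A₀ | L zero in L₀
... | false | _ = trans (ℤP.+-identityˡ _) (sumFin-twoValued n _ _ _ V₁ V₂ (λ i → F-values (suc i)))
... | true | true =
  trans (cong₂ _+ᶻ_ (trans (F-values zero A₀) (cong (if_then V₁ else V₂) L₀))
                    (sumFin-twoValued n _ _ _ V₁ V₂ (λ i → F-values (suc i))))
        (trans (ring V₁ V₂ (+ c₁) (+ c₂)) (cong (λ z → z *ᶻ V₁ +ᶻ + c₂ *ᶻ V₂) (sym (ℤP.pos-+ 1 c₁))))
  where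
  c₁ c₂ : ℕ
  c₁ = count n (λ i → A (suc i) ∧ L (suc i))
  c₂ = count n (λ i → A (suc i) ∧ not (L (suc i)))
  ring : ∀ v₁ v₂ c₁ c₂ → v₁ +ᶻ (c₁ *ᶻ v₁ +ᶻ c₂ *ᶻ v₂) ≡ (+ 1 +ᶻ c₁) *ᶻ v₁ +ᶻ c₂ *ᶻ v₂
  ring = solve-∀
... | true | false =
  trans (cong₂ _+ᶻ_ (trans (F-values zero A₀) (cong (if_then V₁ else V₂) L₀))
                    (sumFin-twoValued n _ _ _ V₁ V₂ (λ i → F-values (suc i))))
        (trans (ring V₁ V₂ (+ c₁) (+ c₂)) (cong (λ z → + c₁ *ᶻ V₁ +ᶻ z *ᶻ V₂) (sym (ℤP.pos-+ 1 c₂))))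
  where
  c₁ c₂ : ℕ
  c₁ = count n (λ i → A (suc i) ∧ L (suc i))
  c₂ = count n (λ i → A (suc i) ∧ not (L (suc i)))
  ring : ∀ v₁ v₂ c₁ c₂ → v₂ +ᶻ (c₁ *ᶻ v₁ +ᶻ c₂ *ᶻ v₂) ≡ c₁ *ᶻ v₁ +ᶻ (+ 1 +ᶻ c₂) *ᶻ v₂
  ring = solve-∀

sumList : ∀ {A : Set} → List A → (A → ℤ) → ℤ
sumList [] f = + 0
sumList (x ∷ xs) f = f x +ᶻ sumList xs f

sumList-cong : ∀ {A : Set} (xs : List A) {f g : A → ℤ} → (∀ x → f x ≡ g x) → sumList xs f ≡ sumList xs g
sumList-cong [] f≡g = refl
sumList-cong (x ∷ xs) f≡g = cong₂ _+ᶻ_ (f≡g x) (sumList-cong xs f≡g)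

sumList-zero : ∀ {A : Set} (xs : List A) → sumList xs (λ _ → + 0) ≡ + 0
sumList-zero [] = refl
sumList-zero (x ∷ xs) = trans (ℤP.+-identityˡ _) (sumList-zero xs)

sumList-++ : ∀ {A : Set} (xs ys : List A) f → sumList (xs ++ ys) f ≡ sumList xs f +ᶻ sumList ys f
sumList-++ [] ys f = sym (ℤP.+-identityˡ _)
sumList-++ (x ∷ xs) ys f = trans (cong (f x +ᶻ_) (sumList-++ xs ys f)) (sym (ℤP.+-assoc (f x) _ _))

sumList-map : ∀ {A B : Set} (g : A → B) (xs : List A) f → sumList (map g xs) f ≡ sumList xs (λ x → f (g x))
sumList-map g [] f = refl
sumList-map g (x ∷ xs) f = cong (f (g x) +ᶻ_) (sumList-map g xs f)

sumList-concatMap : ∀ {A B : Set} (g : A → List B) (xs : List A) f →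
  sumList (concatMap g xs) f ≡ sumList xs (λ x → sumList (g x) f)
sumList-concatMap g [] f = refl
sumList-concatMap g (x ∷ xs) f =
  trans (sumList-++ (g x) (concatMap g xs) f) (cong (sumList (g x) f +ᶻ_) (sumList-concatMap g xs f))

sumList-tabulate : ∀ {A : Set} n (g : Fin n → A) f → sumList (tabulate g) f ≡ sumFin n (λ i → f (g i))
sumList-tabulate zero g f = refl
sumList-tabulate (suc n) g f = cong (f (g zero) +ᶻ_) (sumList-tabulate n (λ i → g (suc i)) f)

sumList-allVecs : ∀ m k f → sumList (allVecs m (suc k)) f ≡ sumFin m (λ i → sumList (allVecs m k) (λ w → f (i ∷ w)))
sumList-allVecs m k f =
  trans (sumList-concatMap (λ i → map (i ∷_) (allVecs m k)) (allFin m) f)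
        (trans (sumList-tabulate m (λ i → i) _) (sumFin-cong m (λ i → sumList-map (i ∷_) (allVecs m k) f)))

sumList-χᶻ-∧ : ∀ {A : Set} (xs : List A) (b : Bool) (g : A → Bool) →
  sumList xs (λ x → χᶻ (b ∧ g x)) ≡ (if b then sumList xs (λ x → χᶻ (g x)) else + 0)
sumList-χᶻ-∧ xs true g = refl
sumList-χᶻ-∧ xs false g = sumList-zero xs

length-filter-tabulate : ∀ {A : Set} {P : A → Set} (P? : ∀ x → Dec (P x)) n (f : Fin n → A) →
  length (filter P? (tabulate f)) ≡ count n (λ i → does (P? (f i)))
length-filter-tabulate P? zero f = refl
length-filter-tabulate P? (suc n) f with does (P? (f zero))
... | true = cong suc (length-filter-tabulate P? n (λ i → f (suc i)))
... | false = length-filter-tabulate P? n (λ i → f (suc i))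

length-filter : ∀ {A : Set} {P : A → Set} (P? : ∀ x → Dec (P x)) (xs : List A) →
  + length (filter P? xs) ≡ sumList xs (λ x → χᶻ (does (P? x)))
length-filter P? [] = refl
length-filter P? (x ∷ xs) with does (P? x)
... | true = cong (+ 1 +ᶻ_) (length-filter P? xs)
... | false = trans (length-filter P? xs) (sym (ℤP.+-identityˡ _))

pos-difference : ∀ {c d s} → c + d ≡ s → + d ≡ + s -ᶻ + c
pos-difference {c} {d} c+d≡s =
  trans (ring (+ c) (+ d)) (cong (_-ᶻ + c) (trans (sym (ℤP.pos-+ c d)) (cong +_ c+d≡s)))
  where ring : ∀ a b → b ≡ (a +ᶻ b) -ᶻ a
        ring = solve-∀

rook-byCounts : ∀ k c d (b : Bool) → c + d + χ b ≡ suc k → c ≤ k →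
  + c *ᶻ rook k (c ∸ 1) +ᶻ + d *ᶻ rook k c ≡ rook (suc k) (c + χ b)
rook-byCounts k c d false c+d≡ c≤k = begin
    + c *ᶻ rook k (c ∸ 1) +ᶻ + d *ᶻ rook k c
  ≡⟨ cong (λ z → + c *ᶻ rook k (c ∸ 1) +ᶻ z *ᶻ rook k c)
          (pos-difference {c} {d} (trans (sym (ℕP.+-identityʳ _)) c+d≡)) ⟩
    + c *ᶻ rook k (c ∸ 1) +ᶻ (+ suc k -ᶻ + c) *ᶻ rook k c
  ≡⟨ sym (rook-expand c k c≤k) ⟩
    rook (suc k) c
  ≡⟨ cong (rook (suc k)) (sym (ℕP.+-identityʳ c)) ⟩
    rook (suc k) (c + 0) ∎
  where open ≡-Reasoning
rook-byCounts k c d true c+d≡ c≤k = begin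
    + c *ᶻ rook k (c ∸ 1) +ᶻ + d *ᶻ rook k c
  ≡⟨ cong (λ z → + c *ᶻ rook k (c ∸ 1) +ᶻ z *ᶻ rook k c)
          (pos-difference {c} {d} (ℕP.suc-injective (trans (ℕP.+-comm 1 _) c+d≡))) ⟩
    + c *ᶻ rook k (c ∸ 1) +ᶻ (+ k -ᶻ + c) *ᶻ rook k c
  ≡⟨ sym (rook-expand-suc c k c≤k) ⟩
    rook (suc k) (suc c)
  ≡⟨ cong (rook (suc k)) (ℕP.+-comm 1 c) ⟩
    rook (suc k) (c + 1) ∎
  where open ≡-Reasoning

accepts : ∀ {P : Set} (P? : Dec P) → does P? ≡ true → P
accepts (yes p) _ = p

rejects : ∀ {P : Set} (P? : Dec P) → not (does P?) ≡ true → ¬ P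
rejects P? not-P p with () ← trans (sym (not-injective {y = false} not-P)) (dec-true P? p)

does-≡ᵇ : ∀ {P : Set} (P? : Dec P) (b : Bool) → (P → b ≡ true) → (b ≡ true → P) → does P? ≡ b
does-≡ᵇ (yes p) b P⇒b _ = sym (P⇒b p)
does-≡ᵇ (no ¬p) true _ b⇒P = ⊥-elim (¬p (b⇒P refl))
does-≡ᵇ (no ¬p) false _ _ = refl

not-∨-∧ : ∀ a b c → not (a ∨ b) ∧ c ≡ (not b ∧ c) ∧ not a
not-∨-∧ true b c = sym (∧-zeroʳ _)
not-∨-∧ false b c = sym (∧-identityʳ _)

-- Fillings of positions by distinct values

module Filling (m′ : ℕ) where

  m : ℕ
  m = suc m′

  open import Data.List.Membership.DecPropositional (_≟_ {m}) using (_∈?_; _∉_)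
  open import Data.List.Relation.Unary.Any using (here; there)

  -- value 0 is kept for the last position
  avail : List (Fin m) → Fin m → Bool
  avail U x = not (does (x ∈? U)) ∧ not (x == zero)

  window : ℕ → ℕ → Fin m → Bool
  window p k x = does (p ℕ.≤? toℕ x) ∧ does (toℕ x ℕ.<? p + k)

  -- the available values whose own position is still to be filled: the forbidden
  -- cells of the board formed by the remaining values and positions
  live : List (Fin m) → ℕ → ℕ → Fin m → Bool
  live U p k x = avail U x ∧ window p k x

  fresh : List (Fin m) → ℕ → Fin m → Bool
  fresh U p x = avail U x ∧ not (does (toℕ x ℕ.≟ p))

  fills : List (Fin m) → ℕ → (k : ℕ) → Vec (Fin m) (suc k) → Bool
  fills U p zero (x ∷ []) = x == zero
  fills U p (suc k) (x ∷ w) = fresh U p x ∧ fills (x ∷ U) (suc p) k w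

  #fills : List (Fin m) → ℕ → ℕ → ℤ
  #fills U p k = sumList (allVecs m (suc k)) (λ w → χᶻ (fills U p k w))

  #fills-zero : ∀ U p → #fills U p 0 ≡ + 1
  #fills-zero U p = trans (sumList-allVecs m 0 (λ w → χᶻ (fills U p 0 w))) (cong (+ 1 +ᶻ_) (sumFin-zero m′))

  #fills-suc : ∀ U p k → #fills U p (suc k)
    ≡ sumFin m (λ i → if fresh U p i then #fills (i ∷ U) (suc p) k else + 0)
  #fills-suc U p k =
    trans (sumList-allVecs m (suc k) _)
          (sumFin-cong m (λ i → sumList-χᶻ-∧ (allVecs m (suc k)) (fresh U p i) (fills (i ∷ U) (suc p) k)))

  avail-∷ : ∀ U i j → avail (i ∷ U) j ≡ avail U j ∧ not (j == i)
  avail-∷ U i j = not-∨-∧ (j == i) (does (j ∈? U)) (not (j == zero))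

  count-avail-∷ : ∀ U i → avail U i ≡ true → count m (avail (i ∷ U)) + 1 ≡ count m (avail U)
  count-avail-∷ U i avail-i =
    trans (cong₂ _+_ (count-cong m (avail-∷ U i)) (cong χ (sym avail-i))) (count-remove m (avail U) i)

  window-empty : ∀ p x → window p 0 x ≡ false
  window-empty p x = dec-false (p ℕ.≤? toℕ x ×-dec toℕ x ℕ.<? p + 0) empty
    where empty : ¬ (p ≤ toℕ x × toℕ x < p + 0)
          empty (p≤x , x<p+0) = ℕP.<⇒≱ (subst (toℕ x <_) (ℕP.+-identityʳ p) x<p+0) p≤x

  module FirstPosition (U : List (Fin m)) (p k : ℕ) (fits : p + suc (suc k) ≡ m) where

    window⊆ : p + suc k ≤ m
    window⊆ = ℕP.≤-trans (ℕP.n≤1+n _) (ℕP.≤-reflexive (trans (sym (ℕP.+-suc p (suc k))) fits))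

    p<m : p < m
    p<m = ℕP.<-≤-trans (ℕP.m<m+n p ℕP.0<1+n) window⊆

    p̂ : Fin m
    p̂ = fromℕ< p<m

    toℕ-p̂ : toℕ p̂ ≡ p
    toℕ-p̂ = toℕ-fromℕ< p<m

    at-p : ∀ j → does (toℕ j ℕ.≟ p) ≡ j == p̂
    at-p j = does-⇔ (mk⇔ (λ j≡p → toℕ-injective (trans j≡p (sym toℕ-p̂)))
                         (λ j≡p̂ → trans (cong toℕ j≡p̂) toℕ-p̂))
                    (toℕ j ℕ.≟ p) (j ≟ p̂)

    window-suc : ∀ j → window (suc p) k j ≡ (does (p ℕ.≤? toℕ j) ∧ not (j == p̂)) ∧ does (toℕ j ℕ.<? p + suc k)
    window-suc j = cong₂ _∧_ (does-⇔ (mk⇔ after before) (suc p ℕ.≤? toℕ j) (p ℕ.≤? toℕ j ×-dec ¬? (j ≟ p̂)))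
                             (cong (λ q → does (toℕ j ℕ.<? q)) (sym (ℕP.+-suc p k)))
      where
      after : suc p ≤ toℕ j → p ≤ toℕ j × j ≢ p̂
      after p<j = ℕP.<⇒≤ p<j , λ j≡p̂ → ℕP.<⇒≢ p<j (sym (trans (cong toℕ j≡p̂) toℕ-p̂))
      before : p ≤ toℕ j × j ≢ p̂ → suc p ≤ toℕ j
      before (p≤j , j≢p̂) = ℕP.≤∧≢⇒< p≤j (λ p≡j → j≢p̂ (toℕ-injective (trans (sym p≡j) (sym toℕ-p̂))))

    window-p̂ : window p (suc k) p̂ ≡ true
    window-p̂ = dec-true (p ℕ.≤? toℕ p̂ ×-dec toℕ p̂ ℕ.<? p + suc k)
      (ℕP.≤-reflexive (sym toℕ-p̂) , subst (_< p + suc k) (sym toℕ-p̂) (ℕP.m<m+n p ℕP.0<1+n))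

    L : Fin m → Bool
    L = live U p (suc k)

    X : Fin m → Bool
    X j = L j ∧ not (j == p̂)

    c : ℕ
    c = count m X

    live-∷ : ∀ i j → live (i ∷ U) (suc p) k j ≡ X j ∧ not (j == i)
    live-∷ i j =
      trans (cong₂ _∧_ (avail-∷ U i j) (window-suc j))
            (solve 5 (λ a e l f r → (a ∧′ e) ∧′ ((l ∧′ f) ∧′ r) ⊜ ((a ∧′ (l ∧′ r)) ∧′ f) ∧′ e)
                   refl
                   (avail U j) (not (j == i)) (does (p ℕ.≤? toℕ j)) (not (j == p̂)) (does (toℕ j ℕ.<? p + suc k)))

    count-live-∷ : ∀ i → i ≢ p̂ → count m (live (i ∷ U) (suc p) k) + χ (L i) ≡ c
    count-live-∷ i i≢p̂ = trans (cong₂ _+_ (count-cong m (live-∷ i)) (cong χ (sym X≡L))) (count-remove m X i)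
      where X≡L : X i ≡ L i
            X≡L = trans (cong (λ b → L i ∧ not b) (dec-false (i ≟ p̂) i≢p̂)) (∧-identityʳ (L i))

    count-fresh : count m (fresh U p) + χ (avail U p̂) ≡ count m (avail U)
    count-fresh = trans (cong (_+ χ (avail U p̂)) (count-cong m (λ j → cong (λ e → avail U j ∧ not e) (at-p j))))
                        (count-remove m (avail U) p̂)

    count-fresh∧live : count m (λ j → fresh U p j ∧ L j) ≡ c
    count-fresh∧live = count-cong m (λ j →
      trans (cong (λ e → (avail U j ∧ not e) ∧ L j) (at-p j))
            (solve 3 (λ a e w → (a ∧′ e) ∧′ (a ∧′ w) ⊜ (a ∧′ w) ∧′ e)
                   refl (avail U j) (not (j == p̂)) (window p (suc k) j)))

    c+χ≡count-live : c + χ (avail U p̂) ≡ count m L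
    c+χ≡count-live = trans (cong (λ b → c + χ b) (sym L-p̂)) (count-remove m L p̂)
      where L-p̂ : L p̂ ≡ avail U p̂
            L-p̂ = trans (cong (avail U p̂ ∧_) window-p̂) (∧-identityʳ (avail U p̂))

    c≤k : c ≤ k
    c≤k = ℕP.≤-trans (count-mono m X W′ X⇒W′)
                     (ℕP.≤-reflexive (ℕP.suc-injective (trans (ℕP.+-comm 1 (count m W′)) count-W′)))
      where
      W′ : Fin m → Bool
      W′ j = window p (suc k) j ∧ not (j == p̂)
      X⇒W′ : ∀ j → X j ≡ true → W′ j ≡ true
      X⇒W′ j X-j = cong₂ _∧_ (∧-conicalʳ (avail U j) _ (∧-conicalˡ (L j) _ X-j)) (∧-conicalʳ (L j) _ X-j)
      count-W′ : count m W′ + 1 ≡ suc k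
      count-W′ = trans (cong (λ b → count m W′ + χ b) (sym window-p̂))
                       (trans (count-remove m (window p (suc k)) p̂)
                              (trans (count-window m p (p + suc k) window⊆) (ℕP.m+n∸m≡n p (suc k))))

  #fills≡rook : ∀ k U p → p + suc k ≡ m → count m (avail U) ≡ k → #fills U p k ≡ rook k (count m (live U p k))
  #fills≡rook zero U p _ _ =
    trans (#fills-zero U p) (cong (rook 0) (sym (count-const-false m (live U p 0) nothing-live)))
    where nothing-live : ∀ x → live U p 0 x ≡ false
          nothing-live x = trans (cong (avail U x ∧_) (window-empty p x)) (∧-zeroʳ (avail U x))
  #fills≡rook (suc k) U p fits #avail≡ = begin
      #fills U p (suc k)
    ≡⟨ #fills-suc U p k ⟩
      sumFin m (λ i → if fresh U p i then #fills (i ∷ U) (suc p) k else + 0)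
    ≡⟨ sumFin-twoValued m (fresh U p) L (λ i → #fills (i ∷ U) (suc p) k) (rook k (c ∸ 1)) (rook k c) by-IH ⟩
      + count m (λ i → fresh U p i ∧ L i) *ᶻ rook k (c ∸ 1) +ᶻ + d *ᶻ rook k c
    ≡⟨ cong (λ z → + z *ᶻ rook k (c ∸ 1) +ᶻ + d *ᶻ rook k c) count-fresh∧live ⟩
      + c *ᶻ rook k (c ∸ 1) +ᶻ + d *ᶻ rook k c
    ≡⟨ rook-byCounts k c d (avail U p̂) total c≤k ⟩
      rook (suc k) (c + χ (avail U p̂))
    ≡⟨ cong (rook (suc k)) c+χ≡count-live ⟩
      rook (suc k) (count m L) ∎
    where
    open ≡-Reasoning
    open FirstPosition U p k fits
    d : ℕ
    d = count m (λ i → fresh U p i ∧ not (L i))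
    total : c + d + χ (avail U p̂) ≡ suc k
    total = trans (cong (λ z → z + d + χ (avail U p̂)) (sym count-fresh∧live))
                  (trans (cong (_+ χ (avail U p̂)) (sym (count-split m (fresh U p) L))) (trans count-fresh #avail≡))
    rook-at : ∀ b n → n + χ b ≡ c → rook k n ≡ (if b then rook k (c ∸ 1) else rook k c)
    rook-at true n n+1≡c = cong (rook k) (trans (sym (ℕP.m+n∸n≡m n 1)) (cong (_∸ 1) n+1≡c))
    rook-at false n n+0≡c = cong (rook k) (trans (sym (ℕP.+-identityʳ n)) n+0≡c)
    by-IH : ∀ i → fresh U p i ≡ true → #fills (i ∷ U) (suc p) k ≡ (if L i then rook k (c ∸ 1) else rook k c)
    by-IH i fresh-i =
      trans (#fills≡rook k (i ∷ U) (suc p) (trans (sym (ℕP.+-suc p (suc k))) fits) #avail′)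
            (rook-at (L i) _ (count-live-∷ i i≢p̂))
      where
      avail-i : avail U i ≡ true
      avail-i = ∧-conicalˡ (avail U i) _ fresh-i
      i≢p̂ : i ≢ p̂
      i≢p̂ i≡p̂ with () ← trans (sym (∧-conicalʳ (avail U i) _ fresh-i))
                              (cong not (trans (at-p i) (dec-true (i ≟ p̂) i≡p̂)))
      #avail′ : count m (avail (i ∷ U)) ≡ k
      #avail′ = ℕP.suc-injective (trans (ℕP.+-comm 1 _) (trans (count-avail-∷ U i avail-i) #avail≡))

  Distinct : ∀ {k} → Vec (Fin m) k → Set
  Distinct {k} w = ∀ (i j : Fin k) → lookup w i ≡ lookup w j → i ≡ j

  Fills : List (Fin m) → ℕ → (k : ℕ) → Vec (Fin m) (suc k) → Set
  Fills U p k w = Distinct w × (∀ i → lookup w i ∉ U) × (∀ i → toℕ (lookup w i) ≢ p + toℕ i)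
                × lookup w (fromℕ k) ≡ zero

  fills-sound : ∀ k U p (w : Vec (Fin m) (suc k)) → 1 ≤ p + k → zero ∉ U → fills U p k w ≡ true → Fills U p k w
  fills-sound zero U p (x ∷ []) 1≤p 0∉U x-last with refl ← accepts (x ≟ zero) x-last =
    (λ { zero zero _ → refl }) , (λ { zero → 0∉U }) , (λ { zero 0≡p → ℕP.<-irrefl 0≡p 1≤p }) , refl
  fills-sound (suc k) U p (x ∷ t) _ 0∉U fills-xt = distinct , ∉U , off-diagonal , proj₂ (proj₂ (proj₂ IH))
    where
    head-ok : fresh U p x ≡ true
    head-ok = ∧-conicalˡ _ _ fills-xt
    avail-x : avail U x ≡ true
    avail-x = ∧-conicalˡ (avail U x) _ head-ok
    x≢0 : x ≢ zero
    x≢0 = rejects (x ≟ zero) (∧-conicalʳ (not (does (x ∈? U))) _ avail-x)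
    0∉x∷U : zero ∉ x ∷ U
    0∉x∷U (here 0≡x) = x≢0 (sym 0≡x)
    0∉x∷U (there 0∈U) = 0∉U 0∈U
    IH : Fills (x ∷ U) (suc p) k t
    IH = fills-sound k (x ∷ U) (suc p) t (s≤s z≤n) 0∉x∷U (∧-conicalʳ _ _ fills-xt)
    t∉x∷U : ∀ i → lookup t i ∉ x ∷ U
    t∉x∷U = proj₁ (proj₂ IH)
    distinct : Distinct (x ∷ t)
    distinct zero zero _ = refl
    distinct zero (suc j) x≡tj = ⊥-elim (t∉x∷U j (here (sym x≡tj)))
    distinct (suc i) zero ti≡x = ⊥-elim (t∉x∷U i (here ti≡x))
    distinct (suc i) (suc j) ti≡tj = cong suc (proj₁ IH i j ti≡tj)
    ∉U : ∀ i → lookup (x ∷ t) i ∉ U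
    ∉U zero = rejects (x ∈? U) (∧-conicalˡ (not (does (x ∈? U))) _ avail-x)
    ∉U (suc i) ti∈U = t∉x∷U i (there ti∈U)
    off-diagonal : ∀ i → toℕ (lookup (x ∷ t) i) ≢ p + toℕ i
    off-diagonal zero x≡p = rejects (toℕ x ℕ.≟ p) (∧-conicalʳ (avail U x) _ head-ok) (trans x≡p (ℕP.+-identityʳ p))
    off-diagonal (suc i) ti≡p+1+i = proj₁ (proj₂ (proj₂ IH)) i (trans ti≡p+1+i (ℕP.+-suc p (toℕ i)))

  fills-complete : ∀ k U p (w : Vec (Fin m) (suc k)) → Fills U p k w → fills U p k w ≡ true
  fills-complete zero U p (x ∷ []) (_ , _ , _ , x≡0) = dec-true (x ≟ zero) x≡0
  fills-complete (suc k) U p (x ∷ t) (distinct , ∉U , off-diagonal , last≡0) =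
    cong₂ _∧_ (cong₂ _∧_ (cong₂ _∧_ (accept (x ∈? U) (∉U zero)) (accept (x ≟ zero) x≢0))
                         (accept (toℕ x ℕ.≟ p) (λ x≡p → off-diagonal zero (trans x≡p (sym (ℕP.+-identityʳ p))))))
              (fills-complete k (x ∷ U) (suc p) t (distinct-t , t∉x∷U , off-diagonal-t , last≡0))
    where
    accept : ∀ {P : Set} (P? : Dec P) → ¬ P → not (does P?) ≡ true
    accept P? ¬P = cong not (dec-false P? ¬P)
    x≢0 : x ≢ zero
    x≢0 x≡0 with () ← distinct zero (suc (fromℕ k)) (trans x≡0 (sym last≡0))
    distinct-t : Distinct t
    distinct-t i j ti≡tj = suc-injective (distinct (suc i) (suc j) ti≡tj)
    t∉x∷U : ∀ i → lookup t i ∉ x ∷ U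
    t∉x∷U i (here ti≡x) with () ← distinct (suc i) zero ti≡x
    t∉x∷U i (there ti∈U) = ∉U (suc i) ti∈U
    off-diagonal-t : ∀ i → toℕ (lookup t i) ≢ suc p + toℕ i
    off-diagonal-t i ti≡ = off-diagonal (suc i) (trans ti≡ (sym (ℕP.+-suc p (toℕ i))))

  last : Fin m
  last = fromℕ m′

  module _ (σ : Vec (Fin m) m) where

    rlMin-last : IsRLMin σ last
    rlMin-last k last<k =
      ⊥-elim (ℕP.<⇒≱ (subst (ℕ._< toℕ k) (toℕ-fromℕ m′) last<k) (toℕ≤pred[n] k))

    before-last : ∀ i → i ≢ last → i F.< last
    before-last i i≢last = subst (toℕ i ℕ.<_) (sym (toℕ-fromℕ m′))
      (ℕP.≤∧≢⇒< (toℕ≤pred[n] i) (λ i≡m′ → i≢last (toℕ-injective (trans i≡m′ (sym (toℕ-fromℕ m′))))))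

    rlMin-only-last : lookup σ last ≡ zero → ∀ i → i ≢ last → ¬ IsRLMin σ i
    rlMin-only-last σℓ≡0 i i≢last rl =
      ℕP.n≮0 (subst (λ v → toℕ (lookup σ i) < toℕ v) σℓ≡0 (rl last (before-last i i≢last)))

    rlMin-zero : IsPerm σ → ∀ i → lookup σ i ≡ zero → IsRLMin σ i
    rlMin-zero σ-perm i σi≡0 k i<k = subst (λ v → toℕ v < toℕ (lookup σ k)) (sym σi≡0)
      (ℕP.n≢0⇒n>0 (λ σk≡0 → ℕP.<-irrefl (cong toℕ (σ-perm i k (trans σi≡0 (sym (toℕ-injective σk≡0))))) i<k))

    perm-hits-zero : IsPerm σ → ∃ λ i → lookup σ i ≡ zero
    perm-hits-zero σ-perm with any? (λ i → lookup σ i ≟ zero)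
    ... | yes hit = hit
    ... | no miss = ⊥-elim (<⇒notInjective (ℕP.n<1+n m′) squeeze-injective)
      where
      0≢σ : ∀ i → zero ≢ lookup σ i
      0≢σ i 0≡σi = miss (i , sym 0≡σi)
      squeeze : Fin m → Fin m′
      squeeze i = punchOut (0≢σ i)
      squeeze-injective : Injective _≡_ _≡_ squeeze
      squeeze-injective {i} {j} e = σ-perm i j (punchOut-injective (0≢σ i) (0≢σ j) e)

    numRLMin-count : numRLMin σ ≡ count m (λ i → does (isRLMin? σ i))
    numRLMin-count = length-filter-tabulate (isRLMin? σ) m (λ i → i)

    numRLMin≡1⇒last≡0 : IsPerm σ → numRLMin σ ≡ 1 → lookup σ last ≡ zero
    numRLMin≡1⇒last≡0 σ-perm one with lookup σ last ≟ zero
    ... | yes σℓ≡0 = σℓ≡0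
    ... | no σℓ≢0 with i , σi≡0 ← perm-hits-zero σ-perm =
      ⊥-elim (ℕP.<-irrefl refl (ℕP.≤-trans two-minima (ℕP.≤-reflexive (trans (sym numRLMin-count) one))))
      where
      two-minima : 2 ≤ count m (λ i → does (isRLMin? σ i))
      two-minima = count-≥2 m _ i last (dec-true (isRLMin? σ i) (rlMin-zero σ-perm i σi≡0))
                                       (dec-true (isRLMin? σ last) rlMin-last)
                                       (λ i≡last → σℓ≢0 (trans (cong (lookup σ) (sym i≡last)) σi≡0))

    last≡0⇒numRLMin≡1 : lookup σ last ≡ zero → numRLMin σ ≡ 1
    last≡0⇒numRLMin≡1 σℓ≡0 = trans numRLMin-count (trans (count-cong m only-last) (count-single m last))
      where
      only-last : ∀ i → does (isRLMin? σ i) ≡ i == last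
      only-last i = does-⇔ (mk⇔ (λ rl → decidable-stable (i ≟ last) (λ i≢last → rlMin-only-last σℓ≡0 i i≢last rl))
                                (λ { refl → rlMin-last }))
                           (isRLMin? σ i) (i ≟ last)

    d1-test≡fills : 1 ≤ m′ →
      does (isPerm? σ ×-dec (isDerangement? σ ×-dec (numRLMin σ ℕ.≟ 1))) ≡ fills [] 0 m′ σ
    d1-test≡fills 1≤m′ = does-≡ᵇ (isPerm? σ ×-dec (isDerangement? σ ×-dec (numRLMin σ ℕ.≟ 1))) _ to from
      where
      to : IsPerm σ × (IsDerangement σ × numRLMin σ ≡ 1) → fills [] 0 m′ σ ≡ true
      to (σ-perm , σ-der , one) = fills-complete m′ [] 0 σ
        (σ-perm , (λ _ ()) , (λ i e → σ-der i (toℕ-injective e)) , numRLMin≡1⇒last≡0 σ-perm one)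
      from : fills [] 0 m′ σ ≡ true → IsPerm σ × (IsDerangement σ × numRLMin σ ≡ 1)
      from fills-σ with σ-perm , _ , off-diagonal , σℓ≡0 ← fills-sound m′ [] 0 σ 1≤m′ (λ ()) fills-σ =
        σ-perm , (λ i e → off-diagonal i (cong toℕ e)) , last≡0⇒numRLMin≡1 σℓ≡0

d1≡rook : ∀ n → + d1 (suc (suc n)) ≡ rook (suc n) n
d1≡rook n = begin
    + d1 m
  ≡⟨ length-filter (λ σ → isPerm? σ ×-dec (isDerangement? σ ×-dec (numRLMin σ ℕ.≟ 1))) (allVecs m m) ⟩
    sumList (allVecs m m) (λ σ → χᶻ (does (isPerm? σ ×-dec (isDerangement? σ ×-dec (numRLMin σ ℕ.≟ 1)))))
  ≡⟨ sumList-cong (allVecs m m) (λ σ → cong χᶻ (d1-test≡fills σ (s≤s z≤n))) ⟩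
    #fills [] 0 (suc n)
  ≡⟨ #fills≡rook (suc n) [] 0 refl (count-const-true (suc n)) ⟩
    rook (suc n) (count m (live [] 0 (suc n)))
  ≡⟨ cong (rook (suc n)) (count-window (suc n) 0 n (ℕP.n≤1+n n)) ⟩
    rook (suc n) n ∎
  where
  open ≡-Reasoning
  open Filling (suc n)

corollary3p1 : JFractionEq (λ n → + d1 (n + 2)) γc βc
corollary3p1 n = suc n , λ k n<k → begin
    convergent γc βc k 0 n
  ≡⟨ convergent≡T k n n<k ⟩
    T n 0
  ≡⟨ sym (rook-diag n) ⟩
    rook (suc n) n
  ≡⟨ sym (d1≡rook n) ⟩
    + d1 (2 + n)
  ≡⟨ cong (λ j → + d1 j) (ℕP.+-comm 2 n) ⟩
    + d1 (n + 2) ∎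
  where open ≡-Reasoning
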